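{- Let $k,m\geq 3$ be integers and $\Gamma=\mathbb{Z}_{k^2m}\oplus \mathbb{Z}_m$. Then there exists a $\Gamma$-magic square $\mathrm{MS}_{\Gamma}(km)$ of side $km$.
   Context: For an Abelian group $(\Gamma,+)$ of order $n^2$, a $\Gamma$-magic square $\mathrm{MS}_{\Gamma}(n)$ (of side $n$) is an $n\times n$ array whose entries are all the elements of $\Gamma$ (each element appearing exactly once) such that all row sums, all column sums, the sum along the main diagonal and the sum along the backward main diagonal are equal to the same element $\mu\in\Gamma$. $\mathbb{Z}_r$ denotes the cyclic group of order $r$. -}

module Defs where

open import Data.Nat using (ℕ; zero; suc; _*_; NonZero; _≤_)
open import Data.Nat.DivMod using (_mod_)
open import Data.Fin using (Fin; toℕ; opposite)
open import Data.Product using (_×_; _,_; Σ; uncurry)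
open import Function.Definitions using (Bijective)
open import Relation.Binary.PropositionalEquality using (_≡_)
import Data.Nat as ℕ

ℤ_ : ℕ → Set
ℤ_ r = Fin r

_+ᶻ_ : ∀ {r} → Fin r → Fin r → Fin r
_+ᶻ_ {suc r} a b = (toℕ a ℕ.+ toℕ b) mod (suc r)

0ᶻ : ∀ {r} .{{_ : NonZero r}} → Fin r
0ᶻ {suc r} = Fin.zero
  where import Data.Fin as Fin

_⊕_ : ℕ → ℕ → Set
a ⊕ b = ℤ_ a × ℤ_ b

_+⊕_ : ∀ {a b} → a ⊕ b → a ⊕ b → a ⊕ b
(x₁ , y₁) +⊕ (x₂ , y₂) = (x₁ +ᶻ x₂) , (y₁ +ᶻ y₂)

sum⊕ : ∀ {a b n} .{{_ : NonZero a}} .{{_ : NonZero b}} → (Fin n → a ⊕ b) → a ⊕ b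
sum⊕ {n = zero} f = 0ᶻ , 0ᶻ
sum⊕ {n = suc n} f = f Fin.zero +⊕ sum⊕ (λ i → f (Fin.suc i))
  where import Data.Fin as Fin

record MagicSquare (a b n : ℕ) .{{_ : NonZero a}} .{{_ : NonZero b}} : Set where
  field
    entry     : Fin n → Fin n → a ⊕ b
    bijective : Bijective _≡_ _≡_ (uncurry entry)
    μ         : a ⊕ b
    rows      : ∀ i → sum⊕ (λ j → entry i j) ≡ μ
    columns   : ∀ j → sum⊕ (λ i → entry i j) ≡ μ
    diagonal  : sum⊕ (λ i → entry i i) ≡ μ
    antidiag  : sum⊕ (λ i → entry i (opposite i)) ≡ μ

nz : ∀ {m} → 3 ≤ m → NonZero m
nz {suc m} _ = _

nz³ : ∀ {k m} → 3 ≤ k → 3 ≤ m → NonZero (k * k * m)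
nz³ {suc k} {suc m} _ _ = _

module Submission where

-- Put n = k m.  As k²m = k n, a pair (r , c) ∈ Fin n × Fin n, with c read as (c₁ , c₂) ∈ Fin k × Fin m,
-- is encoded bijectively as (r + n c₁ , c₂) ∈ ℤ_(k²m) ⊕ ℤ_m.  Each of r, c₁, c₂ is a function f of a
-- point t of Fin n with f t + f (n - 1 - t) constant, so its sum is the same along every line on which
-- the coordinate array is balanced, i.e. sums every such f like a permutation of Fin n does.  It remains
-- to find two orthogonal n × n arrays ρ, κ over Fin n whose rows, columns and both diagonals are balanced.
-- For odd n, ρ i j = i + j + (n + 1)/2 and κ i j = ρ i (n - 1 - j) modulo n work, 2 being invertible.
-- For n = 2h, each cell keeps or reflects each coordinate inside its block {i , n-1-i} × {j , n-1-j},
-- depending on the cyclic difference of the two block indices, so that every row of ρ and every column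
-- of κ is reflected exactly h times while (i , j) ↦ (ρ i j , κ i j) is an involution.

open import Data.Bool using (Bool; true; false; not; if_then_else_; _∧_; _∨_)
open import Data.Bool.Properties using (∨-zeroʳ; ∧-zeroʳ; T-≡)
open import Data.Empty using (⊥-elim)
open import Data.Fin as Fin
  using (Fin; toℕ; opposite; combine; remQuot; quotient; remainder; cast; punchOut; _↑ˡ_; _↑ʳ_)
import Data.Fin.Properties as Finₚ
open import Data.Fin.Permutation using (permutation)
open import Data.Nat
open import Data.Nat.DivMod
open import Data.Nat.Properties
open import Data.Nat.Tactic.RingSolver using (solve-∀)
open import Algebra.Properties.Semiring.Sum +-*-semiring
  using (sum; sum-cong-≗; ∑-distrib-+; *-distribˡ-sum; *-distribʳ-sum; sum-permute)
open import Data.Product as Product using (_×_; _,_; proj₁; proj₂; ∃₂; uncurry)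
open import Data.Sum as Sum using (_⊎_; inj₁; inj₂)
open import Function using (id; _∘_; Equivalence)
open import Function.Consequences.Propositional using (strictlySurjective⇒surjective)
import Function.Construct.Composition as Compose
open import Function.Definitions using (Injective; StrictlySurjective; Bijective)
open import Relation.Binary.PropositionalEquality
  using (_≡_; _≢_; refl; sym; trans; cong; cong₂; _≗_; module ≡-Reasoning)
open import Relation.Nullary using (yes; no)

open import Defs

injective⇒surjective : ∀ {n} {f : Fin n → Fin n} → Injective _≡_ _≡_ f → StrictlySurjective _≡_ f
injective⇒surjective {zero} f-inj ()
injective⇒surjective {suc n} {f} f-inj y with Finₚ.any? (λ x → f x Finₚ.≟ y)
... | yes hit = hit
... | no miss = ⊥-elim (<-irrefl refl (Finₚ.injective⇒≤ squeeze-injective))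
  where
  squeeze : Fin (suc n) → Fin n
  squeeze x = punchOut {i = y} (λ y≡fx → miss (x , sym y≡fx))
  squeeze-injective : Injective _≡_ _≡_ squeeze
  squeeze-injective {x} {x′} = f-inj ∘ Finₚ.punchOut-injective {i = y} _ _

sum-reindex : ∀ {n} (F : Fin n → ℕ) {g : Fin n → Fin n} → Injective _≡_ _≡_ g →
              sum (F ∘ g) ≡ sum F
sum-reindex F {g} g-inj = sym (sum-permute F π)
  where
  g⁻¹ : Fin _ → Fin _
  g⁻¹ y = proj₁ (injective⇒surjective g-inj y)
  π = permutation g g⁻¹ (λ y → proj₂ (injective⇒surjective g-inj y))
                        (λ x → g-inj (proj₂ (injective⇒surjective g-inj (g x))))

sum-const : ∀ n C → sum {n} (λ _ → C) ≡ n * C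
sum-const zero    C = refl
sum-const (suc n) C = cong (C +_) (sum-const n C)

sum-↑ : ∀ a b (F : Fin (a + b) → ℕ) → sum F ≡ sum (F ∘ (_↑ˡ b)) + sum (F ∘ (a ↑ʳ_))
sum-↑ zero    b F = refl
sum-↑ (suc a) b F = trans (cong (F Fin.zero +_) (sum-↑ a b (F ∘ Fin.suc))) (sym (+-assoc (F Fin.zero) _ _))

injective⇒bijective² : ∀ {n} {φ : Fin n × Fin n → Fin n × Fin n} → Injective _≡_ _≡_ φ → Bijective _≡_ _≡_ φ
injective⇒bijective² {n} {φ} φ-inj = φ-inj , strictlySurjective⇒surjective φ-hits
  where
  uncombine-combine : ∀ p → remQuot {n} n (uncurry combine p) ≡ p
  uncombine-combine (i , j) = Finₚ.remQuot-combine i j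
  combine-injective : Injective _≡_ _≡_ (uncurry (combine {n} {n}))
  combine-injective {p} {p′} eq =
    trans (sym (uncombine-combine p)) (trans (cong (remQuot n) eq) (uncombine-combine p′))
  ψ : Fin (n * n) → Fin (n * n)
  ψ = uncurry combine ∘ φ ∘ remQuot n
  ψ-injective : Injective _≡_ _≡_ ψ
  ψ-injective {y} {y′} eq = trans (sym (Finₚ.combine-remQuot {n} n y))
    (trans (cong (uncurry combine) (φ-inj (combine-injective eq))) (Finₚ.combine-remQuot {n} n y′))
  φ-hits : StrictlySurjective _≡_ φ
  φ-hits p with y , ψy≡p ← injective⇒surjective ψ-injective (uncurry combine p) =
    remQuot n y , combine-injective ψy≡p

[_] : Bool → ℕ
[ true ]  = 1
[ false ] = 0

sum-[b]+[not-b] : ∀ {n} (b : Fin n → Bool) → sum ([_] ∘ b) + sum ([_] ∘ not ∘ b) ≡ n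
sum-[b]+[not-b] {n} b = begin
  sum ([_] ∘ b) + sum ([_] ∘ not ∘ b)    ≡⟨ ∑-distrib-+ ([_] ∘ b) ([_] ∘ not ∘ b) ⟨
  sum (λ t → [ b t ] + [ not (b t) ])     ≡⟨ sum-cong-≗ (λ t → [b]+[not-b] (b t)) ⟩
  sum {n} (λ _ → 1)                       ≡⟨ sum-const n 1 ⟩
  n * 1                                   ≡⟨ *-identityʳ n ⟩
  n                                       ∎
  where
  open ≡-Reasoning
  [b]+[not-b] : ∀ b → [ b ] + [ not b ] ≡ 1
  [b]+[not-b] true  = refl
  [b]+[not-b] false = refl

[∨]-disjoint : ∀ x y → (x ≡ true → y ≡ false) → [ x ∨ y ] ≡ [ x ] + [ y ]
[∨]-disjoint true  y x⇒¬y rewrite x⇒¬y refl = refl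
[∨]-disjoint false y _ = refl

count : ∀ h → (ℕ → Bool) → ℕ
count h P = sum {h} ([_] ∘ P ∘ toℕ)

count-false : ∀ h → count h (λ _ → false) ≡ 0
count-false h = trans (sum-const h 0) (*-zeroʳ h)

count-< : ∀ h p → p ≤ h → count h (_<ᵇ p) ≡ p
count-< zero    zero    z≤n       = refl
count-< (suc h) zero    z≤n       = count-false (suc h)
count-< (suc h) (suc p) (s≤s p≤h) = cong suc (count-< h p p≤h)

count-≡ : ∀ h q → q < h → count h (_≡ᵇ q) ≡ 1
count-≡ (suc h) zero    _         = cong suc (count-false h)
count-≡ (suc h) (suc q) (s≤s q<h) = count-≡ h q q<h

count-singleton : ∀ h o q → (o ≡ true → q < h) → count h (λ d → o ∧ (d ≡ᵇ q)) ≡ [ o ]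
count-singleton h true  q q<h = count-≡ h q (q<h refl)
count-singleton h false q _   = count-false h

≤⇒≮ᵇ : ∀ {m n} → n ≤ m → (m <ᵇ n) ≡ false
≤⇒≮ᵇ {m} {n} n≤m with m <ᵇ n in m<ᵇn
... | false = refl
... | true  = ⊥-elim (≤⇒≯ n≤m (<ᵇ⇒< m n (Equivalence.from T-≡ m<ᵇn)))

≢⇒≢ᵇ : ∀ {m n} → m ≢ n → (m ≡ᵇ n) ≡ false
≢⇒≢ᵇ {m} {n} m≢n with m ≡ᵇ n in m≡ᵇn
... | false = refl
... | true  = ⊥-elim (m≢n (≡ᵇ⇒≡ m n (Equivalence.from T-≡ m≡ᵇn)))

singleton⇒≡ : ∀ {o d q} → o ∧ (d ≡ᵇ q) ≡ true → o ≡ true × d ≡ q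
singleton⇒≡ {true} {d} {q} eq = refl , ≡ᵇ⇒≡ d q (Equivalence.from T-≡ eq)

toℕ+toℕ-opposite : ∀ {n} (x : Fin n) → suc (toℕ x + toℕ (opposite x)) ≡ n
toℕ+toℕ-opposite x =
  trans (cong (λ y → suc (toℕ x + y)) (Finₚ.opposite-prop x)) (m+[n∸m]≡n (Finₚ.toℕ<n x))

opposite-unique : ∀ {n} {x y : Fin n} → suc (toℕ x + toℕ y) ≡ n → y ≡ opposite x
opposite-unique {x = x} eq =
  Finₚ.toℕ-injective (+-cancelˡ-≡ (suc (toℕ x)) _ _ (trans eq (sym (toℕ+toℕ-opposite x))))

opposite-injective : ∀ {n} → Injective _≡_ _≡_ (opposite {n})
opposite-injective {x = x} {y} eq =
  trans (sym (Finₚ.opposite-involutive x)) (trans (cong opposite eq) (Finₚ.opposite-involutive y))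

-- Balanced lines

Complementary : ∀ {n} → (Fin n → ℕ) → ℕ → Set
Complementary f C = ∀ t → f t + f (opposite t) ≡ C

-- Every permutation of Fin n is balanced, but so is any line that pairs up into complementary values.
Balanced : ∀ {n} → (Fin n → Fin n) → Set
Balanced {n} g = ∀ f C → Complementary f C → 2 * sum (f ∘ g) ≡ n * C

complementary-∘ : ∀ {n k} {f : Fin k → ℕ} {C} {g : Fin n → Fin k} →
                  Complementary f C → (∀ t → g (opposite t) ≡ opposite (g t)) → Complementary (f ∘ g) C
complementary-∘ {f = f} {g = g} f-comp g-opp t = trans (cong (λ x → f (g t) + f x) (g-opp t)) (f-comp (g t))

module _ {n : ℕ} where

  complementary-toℕ : Complementary (toℕ {n}) (n ∸ 1)
  complementary-toℕ t = cong pred (toℕ+toℕ-opposite t)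

  commutes-with-opposite⇒balanced : ∀ {g : Fin n → Fin n} → (∀ t → g (opposite t) ≡ opposite (g t)) → Balanced g
  commutes-with-opposite⇒balanced {g} g-opp f C f-comp = begin
    2 * sum (f ∘ g)                           ≡⟨ cong (sum (f ∘ g) +_) (+-identityʳ _) ⟩
    sum (f ∘ g) + sum (f ∘ g)                 ≡⟨ cong (sum (f ∘ g) +_) (sum-reindex (f ∘ g) opposite-injective) ⟨
    sum (f ∘ g) + sum (f ∘ g ∘ opposite)      ≡⟨ ∑-distrib-+ (f ∘ g) (f ∘ g ∘ opposite) ⟨
    sum (λ t → f (g t) + f (g (opposite t)))  ≡⟨ sum-cong-≗ (complementary-∘ {f = f} {g = g} f-comp g-opp) ⟩
    sum {n} (λ _ → C)                         ≡⟨ sum-const n C ⟩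
    n * C                                     ∎
    where open ≡-Reasoning

  balanced-∘ : ∀ {g π : Fin n → Fin n} → Balanced g → Injective _≡_ _≡_ π → Balanced (g ∘ π)
  balanced-∘ {g} g-bal π-inj f C f-comp = trans (cong (2 *_) (sum-reindex (f ∘ g) π-inj)) (g-bal f C f-comp)

  id-balanced : Balanced (id {A = Fin n})
  id-balanced = commutes-with-opposite⇒balanced (λ _ → refl)

  injective⇒balanced : ∀ {g : Fin n → Fin n} → Injective _≡_ _≡_ g → Balanced g
  injective⇒balanced = balanced-∘ id-balanced

  balanced-cong : ∀ {g g′ : Fin n → Fin n} → g ≗ g′ → Balanced g → Balanced g′
  balanced-cong g≗g′ g-bal f C f-comp =
    trans (cong (2 *_) (sum-cong-≗ (cong f ∘ sym ∘ g≗g′))) (g-bal f C f-comp)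

  balanced-sum : ∀ {g : Fin n → Fin n} → Balanced g → ∀ f C → Complementary f C → sum (f ∘ g) ≡ sum f
  balanced-sum g-bal f C f-comp =
    *-cancelˡ-≡ _ _ 2 (trans (g-bal f C f-comp) (sym (id-balanced f C f-comp)))

  half-flipped⇒balanced : ∀ {h} (X : Fin n) (b : Fin n → Bool) → n ≡ h + h → sum ([_] ∘ b) ≡ h →
                          Balanced (λ t → if b t then opposite X else X)
  half-flipped⇒balanced {h} X b n≡h+h count f C f-comp = begin
    2 * sum (λ t → f (if b t then opposite X else X))
      ≡⟨ cong (2 *_) (sum-cong-≗ (λ t → select (b t))) ⟩
    2 * sum (λ t → [ b t ] * f (opposite X) + [ not (b t) ] * f X)
      ≡⟨ cong (2 *_) (∑-distrib-+ (λ t → [ b t ] * f (opposite X)) (λ t → [ not (b t) ] * f X)) ⟩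
    2 * (sum (λ t → [ b t ] * f (opposite X)) + sum (λ t → [ not (b t) ] * f X))
      ≡⟨ cong₂ (λ u v → 2 * (u + v)) (*-distribʳ-sum (f (opposite X)) ([_] ∘ b)) (*-distribʳ-sum (f X) ([_] ∘ not ∘ b)) ⟨
    2 * (sum ([_] ∘ b) * f (opposite X) + sum ([_] ∘ not ∘ b) * f X)
      ≡⟨ cong₂ (λ u v → 2 * (u * f (opposite X) + v * f X)) count count-not ⟩
    2 * (h * f (opposite X) + h * f X)
      ≡⟨ cong (λ c → 2 * c) (trans (sym (*-distribˡ-+ h _ _)) (cong (h *_) (trans (+-comm (f (opposite X)) (f X)) (f-comp X)))) ⟩
    2 * (h * C)
      ≡⟨ double-product h C ⟩
    (h + h) * C
      ≡⟨ cong (_* C) n≡h+h ⟨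
    n * C ∎
    where
    open ≡-Reasoning
    select : ∀ c → f (if c then opposite X else X) ≡ [ c ] * f (opposite X) + [ not c ] * f X
    select true  = sym (trans (+-identityʳ _) (+-identityʳ _))
    select false = sym (+-identityʳ (f X))
    count-not : sum ([_] ∘ not ∘ b) ≡ h
    count-not = +-cancelˡ-≡ h _ _ (trans (cong (_+ _) (sym count)) (trans (sum-[b]+[not-b] b) n≡h+h))
    double-product : ∀ h C → 2 * (h * C) ≡ (h + h) * C
    double-product = solve-∀

opposite-combine : ∀ {k m} (i : Fin k) (j : Fin m) →
                   combine (opposite i) (opposite j) ≡ opposite (combine i j)
opposite-combine {k} {m} i j = opposite-unique (begin
  suc (toℕ (combine i j) + toℕ (combine (opposite i) (opposite j)))
    ≡⟨ cong₂ (λ x y → suc (x + y)) (Finₚ.toℕ-combine i j) (Finₚ.toℕ-combine (opposite i) (opposite j)) ⟩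
  suc (m * toℕ i + toℕ j + (m * toℕ (opposite i) + toℕ (opposite j)))
    ≡⟨ regroup m (toℕ i) (toℕ (opposite i)) (toℕ j) (toℕ (opposite j)) ⟩
  m * (toℕ i + toℕ (opposite i)) + suc (toℕ j + toℕ (opposite j))
    ≡⟨ cong (m * (toℕ i + toℕ (opposite i)) +_) (toℕ+toℕ-opposite j) ⟩
  m * (toℕ i + toℕ (opposite i)) + m
    ≡⟨ trans (+-comm _ m) (sym (*-suc m _)) ⟩
  m * suc (toℕ i + toℕ (opposite i))
    ≡⟨ cong (m *_) (toℕ+toℕ-opposite i) ⟩
  m * k
    ≡⟨ *-comm m k ⟩
  k * m ∎)
  where
  open ≡-Reasoning
  regroup : ∀ m i i′ j j′ → suc (m * i + j + (m * i′ + j′)) ≡ m * (i + i′) + suc (j + j′)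
  regroup = solve-∀

remQuot-opposite : ∀ {k} m (c : Fin (k * m)) →
                   remQuot m (opposite c) ≡ Product.map opposite opposite (remQuot m c)
remQuot-opposite {k} m c = begin
  remQuot m (opposite c)
    ≡⟨ cong (remQuot m ∘ opposite) (Finₚ.combine-remQuot {k} m c) ⟨
  remQuot m (opposite (combine q r))
    ≡⟨ cong (remQuot m) (opposite-combine q r) ⟨
  remQuot m (combine (opposite q) (opposite r))
    ≡⟨ Finₚ.remQuot-combine (opposite q) (opposite r) ⟩
  Product.map opposite opposite (remQuot m c) ∎
  where
  open ≡-Reasoning
  q = quotient {k} m c
  r = remainder {k} m c

complementary-quotient : ∀ {k} m → Complementary (toℕ ∘ quotient {k} m) (k ∸ 1)
complementary-quotient {k} m =
  complementary-∘ {k * m} {k} {f = toℕ} {g = quotient m} complementary-toℕ (cong proj₁ ∘ remQuot-opposite {k} m)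

complementary-remainder : ∀ {k} m → Complementary (toℕ ∘ remainder {k} m) (m ∸ 1)
complementary-remainder {k} m =
  complementary-∘ {k * m} {m} {f = toℕ} {g = remainder {k} m} complementary-toℕ (cong proj₂ ∘ remQuot-opposite {k} m)

toℕ-mod : ∀ x d .{{_ : NonZero d}} → toℕ (x mod d) ≡ x % d
toℕ-mod x d = Finₚ.toℕ-fromℕ< (m%n<n x d)

[m+n%d]%d≡[m+n]%d : ∀ m n d .{{_ : NonZero d}} → (m + n % d) % d ≡ (m + n) % d
[m+n%d]%d≡[m+n]%d m n d = begin
  (m + n % d) % d          ≡⟨ %-distribˡ-+ m (n % d) d ⟩
  (m % d + n % d % d) % d  ≡⟨ cong (λ x → (m % d + x) % d) (m%n%n≡m%n n d) ⟩
  (m % d + n % d) % d      ≡⟨ %-distribˡ-+ m n d ⟨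
  (m + n) % d              ∎
  where open ≡-Reasoning

module _ {d : ℕ} .{{_ : NonZero d}} where

  [m%d+n]%d≡[m+n]%d : ∀ m n → (m % d + n) % d ≡ (m + n) % d
  [m%d+n]%d≡[m+n]%d m n = trans (cong (_% d) (+-comm (m % d) n))
                            (trans ([m+n%d]%d≡[m+n]%d n m d) (cong (_% d) (+-comm n m)))

  [m*[n%d]]%d≡[m*n]%d : ∀ m n → (m * (n % d)) % d ≡ (m * n) % d
  [m*[n%d]]%d≡[m*n]%d m n = begin
    (m * (n % d)) % d            ≡⟨ %-distribˡ-* m (n % d) d ⟩
    (m % d * (n % d % d)) % d    ≡⟨ cong (λ x → (m % d * x) % d) (m%n%n≡m%n n d) ⟩
    (m % d * (n % d)) % d        ≡⟨ %-distribˡ-* m n d ⟨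
    (m * n) % d                  ∎
    where open ≡-Reasoning

  %-+-congʳ : ∀ {m n} o → m % d ≡ n % d → (m + o) % d ≡ (n + o) % d
  %-+-congʳ {m} {n} o eq = trans (sym ([m%d+n]%d≡[m+n]%d m o)) (trans (cong (λ x → (x + o) % d) eq) ([m%d+n]%d≡[m+n]%d n o))

  %-+-congˡ : ∀ {m n} o → m % d ≡ n % d → (o + m) % d ≡ (o + n) % d
  %-+-congˡ {m} {n} o eq = trans (cong (_% d) (+-comm o m)) (trans (%-+-congʳ o eq) (cong (_% d) (+-comm n o)))

  -- Adding (d - 1) o to both sides completes o to a multiple of d.
  %-+-cancelʳ : ∀ m n o → (m + o) % d ≡ (n + o) % d → m % d ≡ n % d
  %-+-cancelʳ m n o eq = begin
    m % d                        ≡⟨ shift m ⟩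
    (m + o + pred d * o) % d     ≡⟨ %-+-congʳ (pred d * o) eq ⟩
    (n + o + pred d * o) % d     ≡⟨ shift n ⟨
    n % d                        ∎
    where
    open ≡-Reasoning
    shift : ∀ x → x % d ≡ (x + o + pred d * o) % d
    shift x = sym (trans (cong (_% d) (begin
      x + o + pred d * o        ≡⟨ +-assoc x o _ ⟩
      x + suc (pred d) * o      ≡⟨ cong (λ e → x + e * o) (suc-pred d) ⟩
      x + d * o                 ≡⟨ cong (x +_) (*-comm d o) ⟩
      x + o * d                 ∎)) ([m+kn]%n≡m%n x o d))

  %-+-cancelˡ : ∀ m n o → (o + m) % d ≡ (o + n) % d → m % d ≡ n % d
  %-+-cancelˡ m n o eq = %-+-cancelʳ m n o (trans (cong (_% d) (+-comm m o)) (trans eq (cong (_% d) (+-comm o n))))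

  toℕ%-injective : ∀ {x y : Fin d} → toℕ x % d ≡ toℕ y % d → x ≡ y
  toℕ%-injective {x} {y} eq = Finₚ.toℕ-injective
    (trans (sym (m<n⇒m%n≡m (Finₚ.toℕ<n x))) (trans eq (m<n⇒m%n≡m (Finₚ.toℕ<n y))))

  mod≡⇒%≡ : ∀ {m n} → m mod d ≡ n mod d → m % d ≡ n % d
  mod≡⇒%≡ {m} {n} eq = trans (sym (toℕ-mod m d)) (trans (cong toℕ eq) (toℕ-mod n d))

+ᶻ-mod : ∀ {d} (u : Fin (suc d)) x → u +ᶻ (x mod suc d) ≡ (toℕ u + x) mod suc d
+ᶻ-mod {d} u x = Finₚ.toℕ-injective (begin
  toℕ (u +ᶻ (x mod suc d))                ≡⟨ toℕ-mod (toℕ u + toℕ (x mod suc d)) (suc d) ⟩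
  (toℕ u + toℕ (x mod suc d)) % suc d     ≡⟨ cong (λ y → (toℕ u + y) % suc d) (toℕ-mod x (suc d)) ⟩
  (toℕ u + x % suc d) % suc d             ≡⟨ [m+n%d]%d≡[m+n]%d (toℕ u) x (suc d) ⟩
  (toℕ u + x) % suc d                     ≡⟨ toℕ-mod (toℕ u + x) (suc d) ⟨
  toℕ ((toℕ u + x) mod suc d)             ∎)
  where open ≡-Reasoning

sum⊕-toℕ : ∀ {a b n} (f : Fin n → suc a ⊕ suc b) →
           sum⊕ f ≡ (sum (toℕ ∘ proj₁ ∘ f) mod suc a , sum (toℕ ∘ proj₂ ∘ f) mod suc b)
sum⊕-toℕ {n = zero}  f = refl
sum⊕-toℕ {n = suc n} f rewrite sum⊕-toℕ (f ∘ Fin.suc) =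
  cong₂ _,_ (+ᶻ-mod (proj₁ (f Fin.zero)) _) (+ᶻ-mod (proj₂ (f Fin.zero)) _)

-- The encoding of Fin (k m) × Fin (k m) as ℤ_(k²m) ⊕ ℤ_m

module Encoding (k m : ℕ) where

  -- (r , c) ↦ (r + k m ⌊c / m⌋ , c mod m)
  encode : Fin (k * m) × Fin (k * m) → Fin (k * k * m) × Fin m
  encode (r , c) = cast (sym (*-assoc k k m)) (combine (quotient {k} m c) r) , remainder {k} m c

  decode : Fin (k * k * m) × Fin m → Fin (k * m) × Fin (k * m)
  decode (x , s) = remainder {k} (k * m) x′ , combine (quotient {k} (k * m) x′) s
    where x′ = cast (*-assoc k k m) x

  decode-encode : ∀ p → decode (encode p) ≡ p
  decode-encode (r , c) = cong₂ _,_
    (cong proj₂ split)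
    (trans (cong (λ q → combine q (remainder {k} m c)) (cong proj₁ split)) (Finₚ.combine-remQuot {k} m c))
    where
    y = combine (quotient {k} m c) r
    split : remQuot {k} (k * m) (cast (*-assoc k k m) (cast (sym (*-assoc k k m)) y)) ≡ (quotient {k} m c , r)
    split = trans (cong (remQuot {k} (k * m)) (Finₚ.cast-involutive (*-assoc k k m) (sym (*-assoc k k m)) y)) (Finₚ.remQuot-combine (quotient {k} m c) r)

  encode-decode : ∀ p → encode (decode p) ≡ p
  encode-decode (x , s) = cong₂ _,_
    (begin
      cast _ (combine (quotient {k} m (combine q s)) r) ≡⟨ cong (λ q′ → cast _ (combine q′ r)) (cong proj₁ (Finₚ.remQuot-combine {k} q s)) ⟩
      cast _ (combine q r)                              ≡⟨ cong (cast _) (Finₚ.combine-remQuot {k} (k * m) x′) ⟩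
      cast _ x′                                         ≡⟨ Finₚ.cast-involutive (sym (*-assoc k k m)) (*-assoc k k m) x ⟩
      x                                                 ∎)
    (cong proj₂ (Finₚ.remQuot-combine {k} q s))
    where
    open ≡-Reasoning
    x′ = cast (*-assoc k k m) x
    q = quotient {k} (k * m) x′
    r = remainder {k} (k * m) x′

  encode-bijective : Bijective _≡_ _≡_ encode
  encode-bijective =
    (λ {p} {p′} eq → trans (sym (decode-encode p)) (trans (cong decode eq) (decode-encode p′))) ,
    strictlySurjective⇒surjective (λ p → decode p , encode-decode p)

  toℕ-encode₁ : ∀ r c → toℕ (proj₁ (encode (r , c))) ≡ k * m * toℕ (quotient {k} m c) + toℕ r
  toℕ-encode₁ r c = trans (Finₚ.toℕ-cast _ (combine (quotient {k} m c) r)) (Finₚ.toℕ-combine _ r)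

record BalancedSquare {n} (A : Fin n → Fin n → Fin n) : Set where
  field
    rows         : ∀ i → Balanced (A i)
    columns      : ∀ j → Balanced (λ i → A i j)
    diagonal     : Balanced (λ t → A t t)
    antidiagonal : Balanced (λ t → A t (opposite t))

record OrthogonalBalancedPair (n : ℕ) : Set where
  field
    ρ κ        : Fin n → Fin n → Fin n
    orthogonal : Bijective _≡_ _≡_ (uncurry λ i j → ρ i j , κ i j)
    ρ-balanced : BalancedSquare ρ
    κ-balanced : BalancedSquare κ

module _ (k′ m′ : ℕ) where

  private
    k = suc k′
    m = suc m′

  open Encoding k m

  sum-toℕ-encode₁ : ∀ (g h : Fin (k * m) → Fin (k * m)) → sum (λ t → toℕ (proj₁ (encode (g t , h t)))) ≡
                              k * m * sum (toℕ ∘ quotient {k} m ∘ h) + sum (toℕ ∘ g)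
  sum-toℕ-encode₁ g h = begin
    sum (λ t → toℕ (proj₁ (encode (g t , h t))))
      ≡⟨ sum-cong-≗ (λ t → toℕ-encode₁ (g t) (h t)) ⟩
    sum (λ t → k * m * toℕ (quotient {k} m (h t)) + toℕ (g t))
      ≡⟨ ∑-distrib-+ (λ t → k * m * toℕ (quotient {k} m (h t))) (toℕ ∘ g) ⟩
    sum (λ t → k * m * toℕ (quotient {k} m (h t))) + sum (toℕ ∘ g)
      ≡⟨ cong (_+ sum (toℕ ∘ g)) (*-distribˡ-sum (k * m) (toℕ ∘ quotient {k} m ∘ h)) ⟨
    k * m * sum (toℕ ∘ quotient {k} m ∘ h) + sum (toℕ ∘ g) ∎
    where open ≡-Reasoning

  line-sum : ∀ (g h : Fin (k * m) → Fin (k * m)) → sum⊕ (λ t → encode (g t , h t)) ≡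
             ((k * m * sum (toℕ ∘ quotient {k} m ∘ h) + sum (toℕ ∘ g)) mod (k * k * m) ,
              sum (toℕ ∘ remainder {k} m ∘ h) mod m)
  line-sum g h = trans (sum⊕-toℕ (λ t → encode (g t , h t)))
                       (cong (λ x → x mod (k * k * m) , sum (toℕ ∘ remainder {k} m ∘ h) mod m) (sum-toℕ-encode₁ g h))

  balanced-line-sum : ∀ {g h} → Balanced g → Balanced h →
                      sum⊕ (λ t → encode (g t , h t)) ≡ sum⊕ (λ t → encode (t , t))
  balanced-line-sum {g} {h} g-bal h-bal = begin
    sum⊕ (λ t → encode (g t , h t))
      ≡⟨ line-sum g h ⟩
    ((k * m * sum (toℕ ∘ quotient {k} m ∘ h) + sum (toℕ ∘ g)) mod (k * k * m) , sum (toℕ ∘ remainder {k} m ∘ h) mod m)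
      ≡⟨ cong₂ {A = ℕ} {B = ℕ} (λ x y → x mod (k * k * m) , y mod m)
               (cong₂ {A = ℕ} {B = ℕ} (λ u v → k * m * u + v)
                      (balanced-sum {g = h} h-bal (toℕ ∘ quotient {k} m) _ (complementary-quotient {k} m))
                      (balanced-sum {g = g} g-bal toℕ _ (complementary-toℕ {k * m})))
               (balanced-sum {g = h} h-bal (toℕ ∘ remainder {k} m) _ (complementary-remainder {k} m)) ⟩
    ((k * m * sum (toℕ ∘ quotient {k} m) + sum (toℕ {k * m})) mod (k * k * m) , sum (toℕ ∘ remainder {k} m) mod m)
      ≡⟨ line-sum id id ⟨
    sum⊕ (λ t → encode (t , t)) ∎
    where open ≡-Reasoning

  magicSquare : OrthogonalBalancedPair (k * m) → MagicSquare (k * k * m) m (k * m)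
  magicSquare pair = record
    { entry     = entry
    ; bijective = Compose.bijective _≡_ _≡_ _≡_ orthogonal encode-bijective
    ; μ         = sum⊕ (λ t → encode (t , t))
    ; rows      = λ i → balanced-line-sum {ρ i} {κ i} (ρ-rows i) (κ-rows i)
    ; columns   = λ j → balanced-line-sum {λ i → ρ i j} {λ i → κ i j} (ρ-columns j) (κ-columns j)
    ; diagonal  = balanced-line-sum {λ t → ρ t t} {λ t → κ t t} ρ-diagonal κ-diagonal
    ; antidiag  = balanced-line-sum {λ t → ρ t (opposite t)} {λ t → κ t (opposite t)}
                    ρ-antidiagonal κ-antidiagonal
    }
    where
    open OrthogonalBalancedPair pair
    open BalancedSquare ρ-balanced renaming
      (rows to ρ-rows; columns to ρ-columns; diagonal to ρ-diagonal; antidiagonal to ρ-antidiagonal)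
    open BalancedSquare κ-balanced renaming
      (rows to κ-rows; columns to κ-columns; diagonal to κ-diagonal; antidiagonal to κ-antidiagonal)
    entry : Fin (k * m) → Fin (k * m) → Fin (k * k * m) × Fin m
    entry i j = encode (ρ i j , κ i j)

-- Odd n = 2q + 1

module OddPair (q : ℕ) where

  private
    n = suc (q + q)

  double-%-cancel : ∀ a → a % n ≡ (suc q * ((a + a) % n)) % n
  double-%-cancel a = sym (begin
    (suc q * ((a + a) % n)) % n   ≡⟨ [m*[n%d]]%d≡[m*n]%d (suc q) (a + a) ⟩
    (suc q * (a + a)) % n         ≡⟨ cong (_% n) (halving q a) ⟩
    (a + a * n) % n               ≡⟨ [m+kn]%n≡m%n a a n ⟩
    a % n                         ∎)
    where
    open ≡-Reasoning
    halving : ∀ q a → suc q * (a + a) ≡ a + a * suc (q + q)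
    halving = solve-∀

  double-injective : ∀ {a b} → (a + a) % n ≡ (b + b) % n → a % n ≡ b % n
  double-injective {a} {b} eq =
    trans (double-%-cancel a) (trans (cong (λ x → (suc q * x) % n) eq) (sym (double-%-cancel b)))

  ρ κ : Fin n → Fin n → Fin n
  ρ i j = (toℕ i + toℕ j + suc q) mod n
  κ i j = ρ i (opposite j)

  ρ≡⇒%≡ : ∀ {i j i′ j′} → ρ i j ≡ ρ i′ j′ → (toℕ i + toℕ j) % n ≡ (toℕ i′ + toℕ j′) % n
  ρ≡⇒%≡ {i} {j} {i′} {j′} eq = %-+-cancelʳ (toℕ i + toℕ j) (toℕ i′ + toℕ j′) (suc q)
    (mod≡⇒%≡ {m = toℕ i + toℕ j + suc q} {n = toℕ i′ + toℕ j′ + suc q} eq)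

  ρ-rows : ∀ i → Balanced (ρ i)
  ρ-rows i = injective⇒balanced {g = ρ i} λ {j} {j′} eq →
    toℕ%-injective (%-+-cancelˡ (toℕ j) (toℕ j′) (toℕ i) (ρ≡⇒%≡ {i} {j} {i} {j′} eq))

  ρ-columns : ∀ j → Balanced (λ i → ρ i j)
  ρ-columns j = injective⇒balanced {g = λ i → ρ i j} λ {i} {i′} eq →
    toℕ%-injective (%-+-cancelʳ (toℕ i) (toℕ i′) (toℕ j) (ρ≡⇒%≡ {i} {j} {i′} {j} eq))

  ρ-diagonal : Balanced (λ t → ρ t t)
  ρ-diagonal = injective⇒balanced {g = λ t → ρ t t} λ {t} {t′} eq →
    toℕ%-injective (double-injective {toℕ t} {toℕ t′} (ρ≡⇒%≡ {t} {t} {t′} {t′} eq))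

  q<n : q < n
  q<n = s≤s (m≤m+n q q)

  centre : Fin n
  centre = Fin.fromℕ< q<n

  opposite-centre : opposite centre ≡ centre
  opposite-centre =
    sym (opposite-unique {x = centre} {y = centre} (cong (λ c → suc (c + c)) (Finₚ.toℕ-fromℕ< q<n)))

  -- The shift suc q is chosen so that this constant is the fixed point of opposite.
  ρ-antidiagonal≡centre : ∀ t → ρ t (opposite t) ≡ centre
  ρ-antidiagonal≡centre t = toℕ%-injective {x = ρ t (opposite t)} {y = centre} (begin
    toℕ (ρ t (opposite t)) % n    ≡⟨ cong (_% n) (toℕ-mod s n) ⟩
    s % n % n                     ≡⟨ m%n%n≡m%n s n ⟩
    s % n                         ≡⟨ cong (λ x → (x + suc q) % n) (complementary-toℕ t) ⟩
    (q + q + suc q) % n           ≡⟨ cong (_% n) (regroup q) ⟩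
    (q + n) % n                   ≡⟨ [m+n]%n≡m%n q n ⟩
    q % n                         ≡⟨ cong (_% n) (Finₚ.toℕ-fromℕ< q<n) ⟨
    toℕ centre % n                ∎)
    where
    open ≡-Reasoning
    s = toℕ t + toℕ (opposite t) + suc q
    regroup : ∀ q → q + q + suc q ≡ q + suc (q + q)
    regroup = solve-∀

  ρ-antidiagonal : Balanced (λ t → ρ t (opposite t))
  ρ-antidiagonal = balanced-cong {g = λ _ → centre} (sym ∘ ρ-antidiagonal≡centre)
    (commutes-with-opposite⇒balanced {g = λ _ → centre} (λ _ → sym opposite-centre))

  orthogonal-injective : Injective _≡_ _≡_ (uncurry λ i j → ρ i j , κ i j)
  orthogonal-injective {i , j} {i′ , j′} eq = cong₂ _,_ i≡i′ (j≡j′ i≡i′)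
    where
    open ≡-Reasoning
    sum≡ = ρ≡⇒%≡ {i} {j} {i′} {j′} (cong proj₁ eq)
    difference≡ = ρ≡⇒%≡ {i} {opposite j} {i′} {opposite j′} (cong proj₂ eq)
    regroup : ∀ a b c → a + b + (a + c) ≡ a + a + (b + c)
    regroup = solve-∀
    doubled : ∀ i j → toℕ i + toℕ j + (toℕ i + toℕ (opposite j)) ≡ toℕ i + toℕ i + (q + q)
    doubled i j = trans (regroup (toℕ i) (toℕ j) (toℕ (opposite j))) (cong (toℕ i + toℕ i +_) (complementary-toℕ j))
    i≡i′ : i ≡ i′
    i≡i′ = toℕ%-injective {x = i} {y = i′} (double-injective {toℕ i} {toℕ i′}
      (%-+-cancelʳ (toℕ i + toℕ i) (toℕ i′ + toℕ i′) (q + q) (begin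
        (toℕ i + toℕ i + (q + q)) % n                             ≡⟨ cong (_% n) (doubled i j) ⟨
        (toℕ i + toℕ j + (toℕ i + toℕ (opposite j))) % n          ≡⟨ %-+-congʳ {m = toℕ i + toℕ j} {n = toℕ i′ + toℕ j′} (toℕ i + toℕ (opposite j)) sum≡ ⟩
        (toℕ i′ + toℕ j′ + (toℕ i + toℕ (opposite j))) % n        ≡⟨ %-+-congˡ {m = toℕ i + toℕ (opposite j)} {n = toℕ i′ + toℕ (opposite j′)} (toℕ i′ + toℕ j′) difference≡ ⟩
        (toℕ i′ + toℕ j′ + (toℕ i′ + toℕ (opposite j′))) % n      ≡⟨ cong (_% n) (doubled i′ j′) ⟩
        (toℕ i′ + toℕ i′ + (q + q)) % n                           ∎)))
    j≡j′ : i ≡ i′ → j ≡ j′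
    j≡j′ refl = toℕ%-injective {x = j} {y = j′} (%-+-cancelˡ (toℕ j) (toℕ j′) (toℕ i) sum≡)

  pair : OrthogonalBalancedPair n
  pair = record
    { ρ          = ρ
    ; κ          = κ
    ; orthogonal = injective⇒bijective² {φ = uncurry λ i j → ρ i j , κ i j} orthogonal-injective
    ; ρ-balanced = record
      { rows = ρ-rows ; columns = ρ-columns ; diagonal = ρ-diagonal ; antidiagonal = ρ-antidiagonal }
    ; κ-balanced = record
      { rows         = λ i → balanced-∘ {g = ρ i} {π = opposite} (ρ-rows i) opposite-injective
      ; columns      = ρ-columns ∘ opposite
      ; diagonal     = ρ-antidiagonal
      ; antidiagonal = balanced-cong {g = λ t → ρ t t} {g′ = λ t → κ t (opposite t)}
                         (λ t → cong (ρ t) (sym (Finₚ.opposite-involutive t))) ρ-diagonal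
      }
    }

-- Even n = 2h

module Orbits (h : ℕ) where

  orbitOf : Fin h ⊎ Fin h → Fin h
  orbitOf = Sum.[ id , opposite ]′

  isLeft : Fin h ⊎ Fin h → Bool
  isLeft = Sum.[ (λ _ → true) , (λ _ → false) ]′

  orbit : Fin (h + h) → Fin h
  orbit t = orbitOf (Fin.splitAt h t)

  left : Fin (h + h) → Bool
  left t = isLeft (Fin.splitAt h t)

  opposite-↑ˡ : ∀ a → opposite (a ↑ˡ h) ≡ h ↑ʳ opposite a
  opposite-↑ˡ a = sym (opposite-unique (begin
    suc (toℕ (a ↑ˡ h) + toℕ (h ↑ʳ opposite a)) ≡⟨ cong₂ (λ x y → suc (x + y)) (Finₚ.toℕ-↑ˡ a h) (Finₚ.toℕ-↑ʳ h (opposite a)) ⟩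
    suc (toℕ a + (h + toℕ (opposite a)))       ≡⟨ regroup (toℕ a) h (toℕ (opposite a)) ⟩
    h + suc (toℕ a + toℕ (opposite a))         ≡⟨ cong (h +_) (toℕ+toℕ-opposite a) ⟩
    h + h                                      ∎))
    where
    open ≡-Reasoning
    regroup : ∀ a h ā → suc (a + (h + ā)) ≡ h + suc (a + ā)
    regroup = solve-∀

  opposite-↑ʳ : ∀ a → opposite (h ↑ʳ a) ≡ opposite a ↑ˡ h
  opposite-↑ʳ a = begin
    opposite (h ↑ʳ a)                        ≡⟨ cong (λ x → opposite (h ↑ʳ x)) (Finₚ.opposite-involutive a) ⟨
    opposite (h ↑ʳ opposite (opposite a))    ≡⟨ cong opposite (opposite-↑ˡ (opposite a)) ⟨
    opposite (opposite (opposite a ↑ˡ h))    ≡⟨ Finₚ.opposite-involutive _ ⟩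
    opposite a ↑ˡ h                          ∎
    where open ≡-Reasoning

  splitAt-opposite : ∀ t → Fin.splitAt h (opposite t) ≡ Sum.swap (Sum.map opposite opposite (Fin.splitAt h t))
  splitAt-opposite t with Fin.splitAt h t in eq
  ... | inj₁ a rewrite sym (Finₚ.splitAt⁻¹-↑ˡ eq) | opposite-↑ˡ a = Finₚ.splitAt-↑ʳ h h (opposite a)
  ... | inj₂ a rewrite sym (Finₚ.splitAt⁻¹-↑ʳ eq) | opposite-↑ʳ a = Finₚ.splitAt-↑ˡ h (opposite a) h

  orbit-opposite : ∀ t → orbit (opposite t) ≡ orbit t
  orbit-opposite t rewrite splitAt-opposite t with Fin.splitAt h t
  ... | inj₁ a = Finₚ.opposite-involutive a
  ... | inj₂ a = refl

  sum-orbits : ∀ (F : Fin h → Bool → ℕ) → sum (λ t → F (orbit t) (left t)) ≡ sum (λ a → F a true + F a false)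
  sum-orbits F = begin
    sum (λ t → F (orbit t) (left t))
      ≡⟨ sum-↑ h h _ ⟩
    sum (λ a → F (orbit (a ↑ˡ h)) (left (a ↑ˡ h))) + sum (λ a → F (orbit (h ↑ʳ a)) (left (h ↑ʳ a)))
      ≡⟨ cong₂ _+_ (sum-cong-≗ λ a → cong (λ s → F (orbitOf s) (isLeft s)) (Finₚ.splitAt-↑ˡ h a h))
                   (sum-cong-≗ λ a → cong (λ s → F (orbitOf s) (isLeft s)) (Finₚ.splitAt-↑ʳ h h a)) ⟩
    sum (λ a → F a true) + sum (λ a → F (opposite a) false)
      ≡⟨ cong (sum (λ a → F a true) +_) (sum-reindex (λ a → F a false) opposite-injective) ⟩
    sum (λ a → F a true) + sum (λ a → F a false)
      ≡⟨ ∑-distrib-+ (λ a → F a true) (λ a → F a false) ⟨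
    sum (λ a → F a true + F a false) ∎
    where open ≡-Reasoning

module _ {h : ℕ} .{{_ : NonZero h}} where

  rotate-injective : ∀ e → Injective _≡_ _≡_ (λ (a : Fin h) → (toℕ a + e) mod h)
  rotate-injective e {a} {b} eq = toℕ%-injective {x = a} {y = b}
    (%-+-cancelʳ (toℕ a) (toℕ b) e (mod≡⇒%≡ {m = toℕ a + e} {n = toℕ b + e} eq))

  sum-rotate : ∀ (F : ℕ → ℕ) e → sum {h} (λ a → F ((toℕ a + e) % h)) ≡ sum (F ∘ toℕ {h})
  sum-rotate F e = trans (sum-cong-≗ {n = h} (λ a → cong F (sym (toℕ-mod (toℕ a + e) h))))
                         (sum-reindex (F ∘ toℕ) (rotate-injective e))

  diff : Fin h → Fin h → ℕ
  diff a b = (toℕ b + (h ∸ toℕ a)) % h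

  diff-self : ∀ a → diff a a ≡ 0
  diff-self a = trans (cong (_% h) (m+[n∸m]≡n (<⇒≤ (Finₚ.toℕ<n a)))) (n%n≡0 h)

  sum-diffʳ : ∀ F a → sum (λ b → F (diff a b)) ≡ sum (F ∘ toℕ {h})
  sum-diffʳ F a = sum-rotate F (h ∸ toℕ a)

  sum-diffˡ : ∀ F b → sum (λ a → F (diff a b)) ≡ sum (F ∘ toℕ {h})
  sum-diffˡ F b = begin
    sum (λ a → F (diff a b))                          ≡⟨ sum-reindex (λ a → F (diff a b)) opposite-injective ⟨
    sum (λ a → F (diff (opposite a) b))               ≡⟨ sum-cong-≗ {n = h} (cong F ∘ diff-opposite) ⟩
    sum {h} (λ a → F ((toℕ a + suc (toℕ b)) % h))     ≡⟨ sum-rotate F (suc (toℕ b)) ⟩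
    sum (F ∘ toℕ {h})                                 ∎
    where
    open ≡-Reasoning
    swap : ∀ b a → b + suc a ≡ a + suc b
    swap = solve-∀
    diff-opposite : ∀ a → diff (opposite a) b ≡ (toℕ a + suc (toℕ b)) % h
    diff-opposite a = cong (_% h) (begin
      toℕ b + (h ∸ toℕ (opposite a))     ≡⟨ cong (λ x → toℕ b + (h ∸ x)) (Finₚ.opposite-prop a) ⟩
      toℕ b + (h ∸ (h ∸ suc (toℕ a)))    ≡⟨ cong (toℕ b +_) (m∸[m∸n]≡n (Finₚ.toℕ<n a)) ⟩
      toℕ b + suc (toℕ a)                ≡⟨ swap (toℕ b) (toℕ a) ⟩
      toℕ a + suc (toℕ b)                ∎)

-- Which cyclic differences d of the block indices of a cell reflect both of its coordinates, only the
-- row coordinate (in columns of the left half), or only the column coordinate (in rows of the left half).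
record Marking (h : ℕ) : Set where
  field
    both first second : ℕ → Bool
    both-zero         : both 0 ≡ true
    first⇒¬both       : ∀ d → first d ≡ true → both d ≡ false
    second⇒¬both      : ∀ d → second d ≡ true → both d ≡ false
    first⇒¬second     : ∀ d → first d ≡ true → second d ≡ false
    first-count       : count h first + count h both + count h both ≡ h
    second-count      : count h second + count h both + count h both ≡ h

module EvenPair {h : ℕ} .{{_ : NonZero h}} (M : Marking h) where

  open Marking M
  open Orbits h

  δ : Fin (h + h) → Fin (h + h) → ℕ
  δ i j = diff (orbit i) (orbit j)

  flipρ flipκ : Fin (h + h) → Fin (h + h) → Bool
  flipρ i j = (left j ∧ first (δ i j)) ∨ both (δ i j)
  flipκ i j = (left i ∧ second (δ i j)) ∨ both (δ i j)

  flip : Bool → Fin (h + h) → Fin (h + h)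
  flip b x = if b then opposite x else x

  ρ κ : Fin (h + h) → Fin (h + h) → Fin (h + h)
  ρ i j = flip (flipρ i j) i
  κ i j = flip (flipκ i j) j

  flip-opposite : ∀ b x → flip b (opposite x) ≡ opposite (flip b x)
  flip-opposite true  x = refl
  flip-opposite false x = refl

  flip-involutive : ∀ b x → flip b (flip b x) ≡ x
  flip-involutive true  x = Finₚ.opposite-involutive x
  flip-involutive false x = refl

  orbit-flip : ∀ b x → orbit (flip b x) ≡ orbit x
  orbit-flip true  x = orbit-opposite x
  orbit-flip false x = refl

  δ-oppositeˡ : ∀ i j → δ (opposite i) j ≡ δ i j
  δ-oppositeˡ i j = cong (λ a → diff a (orbit j)) (orbit-opposite i)

  δ-oppositeʳ : ∀ i j → δ i (opposite j) ≡ δ i j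
  δ-oppositeʳ i j = cong (diff (orbit i)) (orbit-opposite j)

  ρ-columns : ∀ j → Balanced (λ i → ρ i j)
  ρ-columns j = commutes-with-opposite⇒balanced λ i →
    trans (cong (λ d → flip ((left j ∧ first d) ∨ both d) (opposite i)) (δ-oppositeˡ i j))
          (flip-opposite (flipρ i j) i)

  κ-rows : ∀ i → Balanced (κ i)
  κ-rows i = commutes-with-opposite⇒balanced λ j →
    trans (cong (λ d → flip ((left i ∧ second d) ∨ both d) (opposite j)) (δ-oppositeʳ i j))
          (flip-opposite (flipκ i j) j)

  split-count : ∀ P → (∀ d → P d ≡ true → both d ≡ false) →
                sum {h} (λ a → [ P (toℕ a) ∨ both (toℕ a) ] + [ both (toℕ a) ]) ≡
                count h P + count h both + count h both
  split-count P P⇒¬both = begin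
    sum {h} (λ a → [ P (toℕ a) ∨ both (toℕ a) ] + [ both (toℕ a) ])
      ≡⟨ sum-cong-≗ {n = h} (λ a → cong (_+ [ both (toℕ a) ]) ([∨]-disjoint _ _ (P⇒¬both (toℕ a)))) ⟩
    sum {h} (λ a → [ P (toℕ a) ] + [ both (toℕ a) ] + [ both (toℕ a) ])
      ≡⟨ ∑-distrib-+ {h} (λ a → [ P (toℕ a) ] + [ both (toℕ a) ]) ([_] ∘ both ∘ toℕ) ⟩
    sum {h} (λ a → [ P (toℕ a) ] + [ both (toℕ a) ]) + count h both
      ≡⟨ cong (_+ count h both) (∑-distrib-+ {h} ([_] ∘ P ∘ toℕ) ([_] ∘ both ∘ toℕ)) ⟩
    count h P + count h both + count h both ∎
    where open ≡-Reasoning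

  ρ-row-count : ∀ i → sum ([_] ∘ flipρ i) ≡ h
  ρ-row-count i = begin
    sum ([_] ∘ flipρ i)
      ≡⟨ sum-orbits (λ b l → [ (l ∧ first (diff a b)) ∨ both (diff a b) ]) ⟩
    sum {h} (λ b → [ first (diff a b) ∨ both (diff a b) ] + [ both (diff a b) ])
      ≡⟨ sum-diffʳ (λ d → [ first d ∨ both d ] + [ both d ]) a ⟩
    sum {h} (λ d → [ first (toℕ d) ∨ both (toℕ d) ] + [ both (toℕ d) ])
      ≡⟨ split-count first first⇒¬both ⟩
    count h first + count h both + count h both
      ≡⟨ first-count ⟩
    h ∎
    where
    open ≡-Reasoning
    a = orbit i

  κ-column-count : ∀ j → sum (λ i → [ flipκ i j ]) ≡ h
  κ-column-count j = begin
    sum (λ i → [ flipκ i j ])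
      ≡⟨ sum-orbits (λ a l → [ (l ∧ second (diff a b)) ∨ both (diff a b) ]) ⟩
    sum {h} (λ a → [ second (diff a b) ∨ both (diff a b) ] + [ both (diff a b) ])
      ≡⟨ sum-diffˡ (λ d → [ second d ∨ both d ] + [ both d ]) b ⟩
    sum {h} (λ d → [ second (toℕ d) ∨ both (toℕ d) ] + [ both (toℕ d) ])
      ≡⟨ split-count second second⇒¬both ⟩
    count h second + count h both + count h both
      ≡⟨ second-count ⟩
    h ∎
    where
    open ≡-Reasoning
    b = orbit j

  flipρ-where-δ≡0 : ∀ {i j} → δ i j ≡ 0 → flipρ i j ≡ true
  flipρ-where-δ≡0 {i} {j} δ≡0 = trans (cong (λ d → (left j ∧ first d) ∨ both d) δ≡0)
                                      (trans (cong ((left j ∧ first 0) ∨_) both-zero) (∨-zeroʳ _))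

  flipκ-where-δ≡0 : ∀ {i j} → δ i j ≡ 0 → flipκ i j ≡ true
  flipκ-where-δ≡0 {i} {j} δ≡0 = trans (cong (λ d → (left i ∧ second d) ∨ both d) δ≡0)
                                      (trans (cong ((left i ∧ second 0) ∨_) both-zero) (∨-zeroʳ _))

  δ-diagonal : ∀ t → δ t t ≡ 0
  δ-diagonal t = diff-self (orbit t)

  δ-antidiagonal : ∀ t → δ t (opposite t) ≡ 0
  δ-antidiagonal t = trans (δ-oppositeʳ t t) (δ-diagonal t)

  opposite-balanced : Balanced (opposite {h + h})
  opposite-balanced = injective⇒balanced {g = opposite} opposite-injective

  ρ-diagonal : Balanced (λ t → ρ t t)
  ρ-diagonal = balanced-cong {g = opposite} (λ t → cong (λ b → flip b t) (sym (flipρ-where-δ≡0 (δ-diagonal t))))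
    opposite-balanced

  ρ-antidiagonal : Balanced (λ t → ρ t (opposite t))
  ρ-antidiagonal = balanced-cong {g = opposite} (λ t → cong (λ b → flip b t) (sym (flipρ-where-δ≡0 (δ-antidiagonal t))))
    opposite-balanced

  κ-diagonal : Balanced (λ t → κ t t)
  κ-diagonal = balanced-cong {g = opposite} (λ t → cong (λ b → flip b t) (sym (flipκ-where-δ≡0 (δ-diagonal t))))
    opposite-balanced

  κ-antidiagonal : Balanced (λ t → κ t (opposite t))
  κ-antidiagonal = balanced-cong {g = id}
    (λ t → sym (trans (cong (λ b → flip b (opposite t)) (flipκ-where-δ≡0 (δ-antidiagonal t)))
                      (Finₚ.opposite-involutive t)))
    id-balanced

  second⇒¬first : ∀ d → second d ≡ true → first d ≡ false
  second⇒¬first d second-d with first d in first-d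
  ... | false = refl
  ... | true with () ← trans (sym second-d) (first⇒¬second d first-d)

  flipκ⇒¬first : ∀ i j → flipκ i j ≡ true → first (δ i j) ≡ false
  flipκ⇒¬first i j flipκ-ij with first (δ i j) in first-d
  ... | false = refl
  ... | true with () ← trans (sym flipκ-ij) (trans
        (cong₂ (λ x y → (left i ∧ x) ∨ y) (first⇒¬second _ first-d) (first⇒¬both _ first-d))
        (cong (_∨ false) (∧-zeroʳ (left i))))

  flipρ⇒¬second : ∀ i j → flipρ i j ≡ true → second (δ i j) ≡ false
  flipρ⇒¬second i j flipρ-ij with second (δ i j) in second-d
  ... | false = refl
  ... | true with () ← trans (sym flipρ-ij) (trans
        (cong₂ (λ x y → (left j ∧ x) ∨ y) (second⇒¬first _ second-d) (second⇒¬both _ second-d))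
        (cong (_∨ false) (∧-zeroʳ (left j))))

  left-irrelevant : ∀ {P : ℕ → Bool} {d} l l′ → P d ≡ false → (l ∧ P d) ∨ both d ≡ (l′ ∧ P d) ∨ both d
  left-irrelevant l l′ Pd≡false rewrite Pd≡false | ∧-zeroʳ l | ∧-zeroʳ l′ = refl

  δ-φ : ∀ i j → δ (ρ i j) (κ i j) ≡ δ i j
  δ-φ i j = cong₂ diff (orbit-flip (flipρ i j) i) (orbit-flip (flipκ i j) j)

  -- Moving a cell to (ρ i j , κ i j) keeps δ, and a coordinate whose reflection depends on the side of
  -- the other one is reflected only where that other coordinate is not, so both decisions are kept.
  flipρ-φ : ∀ i j → flipρ (ρ i j) (κ i j) ≡ flipρ i j
  flipρ-φ i j = trans (cong (λ d → (left (κ i j) ∧ first d) ∨ both d) (δ-φ i j)) (same-left (flipκ i j) refl)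
    where
    same-left : ∀ b → flipκ i j ≡ b → (left (flip b j) ∧ first (δ i j)) ∨ both (δ i j) ≡ flipρ i j
    same-left false _  = refl
    same-left true  eq = left-irrelevant {first} _ _ (flipκ⇒¬first i j eq)

  flipκ-φ : ∀ i j → flipκ (ρ i j) (κ i j) ≡ flipκ i j
  flipκ-φ i j = trans (cong (λ d → (left (ρ i j) ∧ second d) ∨ both d) (δ-φ i j)) (same-left (flipρ i j) refl)
    where
    same-left : ∀ b → flipρ i j ≡ b → (left (flip b i) ∧ second (δ i j)) ∨ both (δ i j) ≡ flipκ i j
    same-left false _  = refl
    same-left true  eq = left-irrelevant {second} _ _ (flipρ⇒¬second i j eq)

  φ : Fin (h + h) × Fin (h + h) → Fin (h + h) × Fin (h + h)
  φ = uncurry λ i j → ρ i j , κ i j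

  φ-involutive : ∀ p → φ (φ p) ≡ p
  φ-involutive (i , j) = cong₂ _,_
    (trans (cong (λ b → flip b (ρ i j)) (flipρ-φ i j)) (flip-involutive (flipρ i j) i))
    (trans (cong (λ b → flip b (κ i j)) (flipκ-φ i j)) (flip-involutive (flipκ i j) j))

  pair : OrthogonalBalancedPair (h + h)
  pair = record
    { ρ          = ρ
    ; κ          = κ
    ; orthogonal = (λ {p} {p′} eq → trans (sym (φ-involutive p)) (trans (cong φ eq) (φ-involutive p′))) ,
                   strictlySurjective⇒surjective (λ p → φ p , φ-involutive p)
    ; ρ-balanced = record
      { rows         = λ i → half-flipped⇒balanced i (flipρ i) refl (ρ-row-count i)
      ; columns      = ρ-columns
      ; diagonal     = ρ-diagonal
      ; antidiagonal = ρ-antidiagonal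
      }
    ; κ-balanced = record
      { rows         = κ-rows
      ; columns      = λ j → half-flipped⇒balanced j (λ i → flipκ i j) refl (κ-column-count j)
      ; diagonal     = κ-diagonal
      ; antidiagonal = κ-antidiagonal
      }
    }

-- With h = [ o ] + 2p, differences below p reflect whole blocks; when h is odd, difference p adds the
-- missing reflection of the row coordinate and difference 2p that of the column coordinate.
module _ (o : Bool) (p′ : ℕ) where

  private
    p = suc p′
    h = [ o ] + (p + p)

    p<h : p < h
    p<h = <-≤-trans (m<m+n p z<s) (m≤n+m (p + p) [ o ])

    p+p<h : o ≡ true → p + p < h
    p+p<h refl = ≤-refl

  marking-nonZero : NonZero h
  marking-nonZero = >-nonZero (<-≤-trans z<s p<h)

  marking : Marking h
  marking = record
    { both          = _<ᵇ p
    ; first         = λ d → o ∧ (d ≡ᵇ p)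
    ; second        = λ d → o ∧ (d ≡ᵇ p + p)
    ; both-zero     = refl
    ; first⇒¬both   = λ d first-d →
        trans (cong (_<ᵇ p) (proj₂ (singleton⇒≡ {o} {d} {p} first-d))) (≤⇒≮ᵇ {p} {p} ≤-refl)
    ; second⇒¬both  = λ d second-d →
        trans (cong (_<ᵇ p) (proj₂ (singleton⇒≡ {o} {d} {p + p} second-d))) (≤⇒≮ᵇ {p + p} {p} (m≤m+n p p))
    ; first⇒¬second = first⇒¬second
    ; first-count   = counts {λ d → o ∧ (d ≡ᵇ p)} (count-singleton h o p (λ _ → p<h))
    ; second-count  = counts {λ d → o ∧ (d ≡ᵇ p + p)} (count-singleton h o (p + p) p+p<h)
    }
    where
    first⇒¬second : ∀ d → o ∧ (d ≡ᵇ p) ≡ true → o ∧ (d ≡ᵇ p + p) ≡ false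
    first⇒¬second d first-d with singleton⇒≡ {o} {d} {p} first-d
    ... | refl , refl = ≢⇒≢ᵇ (<⇒≢ (m<m+n p z<s))
    counts : ∀ {P} → count h P ≡ [ o ] → count h P + count h (_<ᵇ p) + count h (_<ᵇ p) ≡ h
    counts {P} count-P = begin
      count h P + count h (_<ᵇ p) + count h (_<ᵇ p) ≡⟨ cong₂ (λ x y → x + y + y) count-P (count-< h p (<⇒≤ p<h)) ⟩
      [ o ] + p + p                                 ≡⟨ +-assoc [ o ] p p ⟩
      h                                             ∎
      where open ≡-Reasoning

half-decomposition : ∀ n → ∃₂ λ o p → n ≡ [ o ] + (p + p)
half-decomposition zero = false , 0 , refl
half-decomposition (suc n) with half-decomposition n
... | false , p , refl = true , p , refl
... | true  , p , refl = false , suc p , cong suc (sym (+-suc p p))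

orthogonalBalancedPair : ∀ n → 3 ≤ n → OrthogonalBalancedPair n
orthogonalBalancedPair n 3≤n with half-decomposition n
... | true  , h , refl = OddPair.pair h
... | false , h , refl with half-decomposition h
...   | o , suc p′ , refl = EvenPair.pair {{marking-nonZero o p′}} (marking o p′)
...   | true  , zero , refl with s≤s (s≤s ()) ← 3≤n
...   | false , zero , refl with () ← 3≤n

lemma4p7 : (k m : ℕ) (hk : 3 ≤ k) (hm : 3 ≤ m) →
    MagicSquare (k * k * m) m (k * m) {{nz³ hk hm}} {{nz hm}}
lemma4p7 (suc k′) (suc m′) hk hm =
  magicSquare k′ m′ (orthogonalBalancedPair (suc k′ * suc m′) (≤-trans (s≤s (s≤s (s≤s z≤n))) (*-mono-≤ hk hm)))
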